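{- For all integers $k,r\ge0$, every graph in $M^k_r$ has diameter at most $2^r$.
   Context: A $k$-precolored graph is a finite simple graph in which at most $k$ vertices are assigned colors from $\{\text{red},\text{blue},\text{green}\}$. A $k$-precolored graph $K$ is a subgraph of a $k$-precolored graph $H$ if the underlying graph of $K$ is a subgraph of that of $H$ and every vertex colored in $K$ has the same color in $H$ (vertices colored in $H$ may be uncolored in $K$); it is a proper subgraph if moreover $K\ne H$ (i.e. $K$ lacks some vertex or edge of $H$, or some vertex colored in $H$ is uncolored in $K$). The game $\mathcal G^k_r(H)$ on a $k$-precolored graph $H$: starting from the given partial coloring, in each of $r$ rounds Spoiler may erase the color of a colored vertex and then selects a vertex, which Duplicator colors red, blue or green; at most $k$ vertices may be colored after each round. Duplicator wins if the partial coloring is proper initially and after each round; otherwise Spoiler wins. $M^k_r$ is the family of all $k$-precolored graphs $H$ such that Spoiler has a winning strategy in $\mathcal G^k_r(H)$ and Duplicator has a winning strategy in $\mathcal G^k_r(K)$ for every proper subgraph $K$ of $H$. The diameter of a graph is the maximum distance between two of its vertices (infinite if disconnected). -}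

module Defs where

open import Data.Nat using (ℕ; zero; suc; _+_; _≤_)
open import Data.Fin using (Fin; zero; suc; _≟_)
open import Data.Bool using (Bool; true; false)
open import Data.Maybe using (Maybe; just; nothing; is-just)
open import Data.Product using (Σ; ∃; ∃-syntax; _×_; _,_)
open import Data.Sum using (_⊎_)
open import Data.Empty using (⊥)
open import Relation.Nullary using (¬_; yes; no)
open import Relation.Binary.PropositionalEquality using (_≡_; _≢_)
open import Function.Definitions using (Injective)

data Colour : Set where
  red blue green : Colour

PartialColouring : ℕ → Set
PartialColouring n = Fin n → Maybe Colour

numColoured : ∀ {n} → PartialColouring n → ℕ
numColoured {zero} c = 0
numColoured {suc n} c with is-just (c zero)
... | true  = suc (numColoured (λ i → c (suc i)))
... | false = numColoured (λ i → c (suc i))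

record PrecolouredGraph (k : ℕ) : Set where
  field
    n      : ℕ
    adj    : Fin n → Fin n → Bool
    sym    : ∀ u v → adj u v ≡ true → adj v u ≡ true
    irrefl : ∀ v → adj v v ≡ false
    col    : PartialColouring n
    atMost : numColoured col ≤ k
open PrecolouredGraph public

ProperColouring : ∀ {n} → (Fin n → Fin n → Bool) → PartialColouring n → Set
ProperColouring adj c =
  ∀ u v x y → adj u v ≡ true → c u ≡ just x → c v ≡ just y → x ≢ y

erase : ∀ {n} → Fin n → PartialColouring n → PartialColouring n
erase u c w with w ≟ u
... | yes _ = nothing
... | no  _ = c w

assign : ∀ {n} → Fin n → Colour → PartialColouring n → PartialColouring n
assign v x c w with w ≟ v
... | yes _ = just x
... | no  _ = c w

-- A Spoiler move: optionally erase the colour of a coloured vertex, then select a vertex.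
data Move {n : ℕ} (c : PartialColouring n) : Set where
  noErase : Fin n → Move c
  eraseThen : (u : Fin n) → is-just (c u) ≡ true → Fin n → Move c

apply : ∀ {n} {c : PartialColouring n} → Move c → Colour → PartialColouring n
apply {c = c} (noErase v) x = assign v x c
apply {c = c} (eraseThen u _ v) x = assign v x (erase u c)

-- A move is legal if, whatever the answer, at most k vertices are coloured afterwards.
-- (The number of coloured vertices after the move does not depend on the colour chosen.)
Legal : ∀ {n} (k : ℕ) {c : PartialColouring n} → Move c → Set
Legal k m = ∀ x → numColoured (apply m x) ≤ k

SpoilerWins : ∀ {n} (k : ℕ) (adj : Fin n → Fin n → Bool) → ℕ → PartialColouring n → Set
SpoilerWins k adj zero c = ¬ ProperColouring adj c
SpoilerWins k adj (suc r) c =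
  ¬ ProperColouring adj c
  ⊎ Σ (Move c) (λ m → Legal k m × (∀ x → SpoilerWins k adj r (apply m x)))

DuplicatorWins : ∀ {n} (k : ℕ) (adj : Fin n → Fin n → Bool) → ℕ → PartialColouring n → Set
DuplicatorWins k adj zero c = ProperColouring adj c
DuplicatorWins k adj (suc r) c =
  ProperColouring adj c
  × ((m : Move c) → Legal k m → Σ Colour (λ x → DuplicatorWins k adj r (apply m x)))

SpoilerWinsGame : ∀ {k} → ℕ → PrecolouredGraph k → Set
SpoilerWinsGame {k} r H = SpoilerWins k (adj H) r (col H)

DuplicatorWinsGame : ∀ {k} → ℕ → PrecolouredGraph k → Set
DuplicatorWinsGame {k} r H = DuplicatorWins k (adj H) r (col H)

record SubgraphVia {k} (K H : PrecolouredGraph k) (f : Fin (n K) → Fin (n H)) : Set where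
  field
    inj      : Injective _≡_ _≡_ f
    edges    : ∀ u v → adj K u v ≡ true → adj H (f u) (f v) ≡ true
    colours  : ∀ v x → col K v ≡ just x → col H (f v) ≡ just x

Differs : ∀ {k} (K H : PrecolouredGraph k) (f : Fin (n K) → Fin (n H)) → Set
Differs K H f =
  (∃[ w ] (∀ v → f v ≢ w))
  ⊎ (∃[ u ] ∃[ v ] (adj H (f u) (f v) ≡ true × adj K u v ≡ false))
  ⊎ (∃[ v ] ∃[ x ] (col H (f v) ≡ just x × col K v ≡ nothing))

ProperSubgraph : ∀ {k} → PrecolouredGraph k → PrecolouredGraph k → Set
ProperSubgraph K H = Σ (Fin (n K) → Fin (n H)) (λ f → SubgraphVia K H f × Differs K H f)

InM : (k r : ℕ) → PrecolouredGraph k → Set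
InM k r H =
  SpoilerWinsGame r H × (∀ (K : PrecolouredGraph k) → ProperSubgraph K H → DuplicatorWinsGame r K)

data Walk {k} (H : PrecolouredGraph k) : Fin (n H) → Fin (n H) → ℕ → Set where
  here : ∀ v → Walk H v v 0
  step : ∀ {u v w ℓ} → adj H u v ≡ true → Walk H v w ℓ → Walk H u w (suc ℓ)

DiameterAtMost : ∀ {k} → PrecolouredGraph k → ℕ → Set
DiameterAtMost H d = ∀ u v → ∃[ ℓ ] (ℓ ≤ d × Walk H u v ℓ)

-- A Spoiler win in r rounds is already a win on the subgraph induced by a
-- vertex set of weak diameter at most 2^r. For r = 0, or an improper start,
-- take a monochromatic edge. Otherwise let v be the vertex Spoiler selects and
-- take such sets for the three answers. If one of them avoids v, then v is
-- isolated in the induced subgraph, the colour Duplicator gives it is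
-- irrelevant, and that set serves for every answer. Otherwise all three
-- contain v, so their union has weak diameter at most 2^r + 2^r, and Spoiler
-- still wins on the larger induced subgraph since adding edges only helps him.
-- In a minimal graph the set must contain every vertex w: if w has a
-- neighbour, dropping the edges outside the set leaves a proper subgraph on
-- which Spoiler wins; if w is isolated, so does deleting w.

module Submission where

open import Algebra.Properties.CommutativeSemigroup using (x∙yz≈y∙xz)
open import Data.Bool using (Bool; true; false; _∧_; _∨_; if_then_else_)
open import Data.Bool.Properties using (∧-conicalˡ; ∧-conicalʳ; ∧-zeroʳ; ∨-zeroʳ)
import Data.Bool.Properties as Bool
open import Data.Fin using (Fin; zero; suc; _≟_; punchIn)
open import Data.Fin.Properties using (any?; punchIn-injective; punchInᵢ≢i; punchIn-punchOut)
open import Data.Maybe using (Maybe; just; nothing; is-just)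
open import Data.Nat using (ℕ; zero; suc; _+_; _≤_; _<_; _^_; z≤n; s≤s; _≤?_)
open import Data.Nat.Properties
  using (≤-refl; ≤-reflexive; ≤-trans; ≤-pred; +-comm; +-mono-≤; +-monoˡ-≤; +-monoʳ-≤; +-cancelʳ-≤;
         m≤m+n; m≤n+m; m^n>0; ≰⇒>; +-commutativeSemigroup; module ≤-Reasoning)
open import Data.Product using (Σ; ∃-syntax; _×_; _,_; proj₁; proj₂)
open import Data.Sum using (_⊎_; inj₁; inj₂)
open import Data.Empty using (⊥-elim)
open import Function using (_∘_; id)
open import Relation.Nullary using (¬_; Dec; yes; no; does)
open import Relation.Nullary.Decidable using (dec-true; decidable-stable; map′; _×-dec_)
open import Relation.Binary.PropositionalEquality
  using (_≡_; _≢_; refl; sym; trans; cong; cong₂; subst; subst₂; module ≡-Reasoning)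

open import Defs renaming (sym to adj-sym)

-- Partial colourings

erase-≡ : ∀ {n} (u : Fin n) (c : PartialColouring n) → erase u c u ≡ nothing
erase-≡ u c with u ≟ u
... | yes _   = refl
... | no u≢u = ⊥-elim (u≢u refl)

erase-≢ : ∀ {n} {u z : Fin n} (c : PartialColouring n) → z ≢ u → erase u c z ≡ c z
erase-≢ {u = u} {z} c z≢u with z ≟ u
... | yes z≡u = ⊥-elim (z≢u z≡u)
... | no _    = refl

assign-≡ : ∀ {n} (v : Fin n) x (c : PartialColouring n) → assign v x c v ≡ just x
assign-≡ v x c with v ≟ v
... | yes _   = refl
... | no v≢v = ⊥-elim (v≢v refl)

assign-≢ : ∀ {n} {v z : Fin n} x (c : PartialColouring n) → z ≢ v → assign v x c z ≡ c z
assign-≢ {v = v} {z} x c z≢v with z ≟ v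
... | yes z≡v = ⊥-elim (z≢v z≡v)
... | no _    = refl

erase-pointwise : ∀ {n} (P : Maybe Colour → Maybe Colour → Set) {c d : PartialColouring n} u z →
                  P nothing nothing → P (c z) (d z) → P (erase u c z) (erase u d z)
erase-pointwise P u z p₀ p with z ≟ u
... | yes _ = p₀
... | no  _ = p

assign-pointwise : ∀ {n} (P : Maybe Colour → Maybe Colour → Set) {c d : PartialColouring n} v x y z →
                   P (just x) (just y) → P (c z) (d z) → P (assign v x c z) (assign v y d z)
assign-pointwise P v x y z p₀ p with z ≟ v
... | yes _ = p₀
... | no  _ = p

erase-punchIn : ∀ {n} (w : Fin (suc n)) u (c : PartialColouring (suc n)) z →
                erase (punchIn w u) c (punchIn w z) ≡ erase u (c ∘ punchIn w) z
erase-punchIn w u c z with z ≟ u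
... | yes refl = erase-≡ (punchIn w z) c
... | no z≢u   = erase-≢ c (z≢u ∘ punchIn-injective w z u)

assign-punchIn : ∀ {n} (w : Fin (suc n)) v x (c : PartialColouring (suc n)) z →
                 assign (punchIn w v) x c (punchIn w z) ≡ assign v x (c ∘ punchIn w) z
assign-punchIn w v x c z with z ≟ v
... | yes refl = assign-≡ (punchIn w z) x c
... | no z≢v   = assign-≢ x c (z≢v ∘ punchIn-injective w z v)

nothing≢just : ∀ {x : Colour} → nothing ≢ just x
nothing≢just ()

false≢true : false ≢ true
false≢true ()

indicator : Maybe Colour → ℕ
indicator a = if is-just a then 1 else 0

indicator≤1 : ∀ a → indicator a ≤ 1
indicator≤1 (just _) = ≤-refl
indicator≤1 nothing  = z≤n

SameSupport : ∀ {n} → PartialColouring n → PartialColouring n → Set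
SameSupport c d = ∀ z → is-just (c z) ≡ is-just (d z)

_⊑_ : ∀ {n} → PartialColouring n → PartialColouring n → Set
c ⊑ d = ∀ z y → c z ≡ just y → d z ≡ just y

indicator-coloured : ∀ {a : Maybe Colour} → is-just a ≡ true → indicator a ≡ 1
indicator-coloured {just _} _ = refl

indicator-mono : ∀ {a b : Maybe Colour} → (∀ y → a ≡ just y → b ≡ just y) → indicator a ≤ indicator b
indicator-mono {nothing} _  = z≤n
indicator-mono {just y} a⊑b rewrite a⊑b y refl = ≤-refl

numColoured-suc : ∀ {n} (c : PartialColouring (suc n)) →
                  numColoured c ≡ indicator (c zero) + numColoured (c ∘ suc)
numColoured-suc c with is-just (c zero)
... | true  = refl
... | false = refl

numColoured-cong : ∀ {n} {c d : PartialColouring n} → SameSupport c d → numColoured c ≡ numColoured d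
numColoured-cong {zero}  _ = refl
numColoured-cong {suc n} {c} {d} same = begin
  numColoured c                                  ≡⟨ numColoured-suc c ⟩
  indicator (c zero) + numColoured (c ∘ suc)     ≡⟨ cong₂ _+_ (cong (λ b → if b then 1 else 0) (same zero))
                                                               (numColoured-cong (same ∘ suc)) ⟩
  indicator (d zero) + numColoured (d ∘ suc)     ≡⟨ numColoured-suc d ⟨
  numColoured d                                  ∎
  where open ≡-Reasoning

numColoured-punchIn : ∀ {n} (w : Fin (suc n)) (c : PartialColouring (suc n)) →
                      numColoured c ≡ indicator (c w) + numColoured (c ∘ punchIn w)
numColoured-punchIn zero c = numColoured-suc c
numColoured-punchIn {suc n} (suc w) c = begin
  numColoured c
    ≡⟨ numColoured-suc c ⟩
  indicator (c zero) + numColoured (c ∘ suc)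
    ≡⟨ cong (indicator (c zero) +_) (numColoured-punchIn w (c ∘ suc)) ⟩
  indicator (c zero) + (indicator (c (suc w)) + numColoured (c ∘ suc ∘ punchIn w))
    ≡⟨ x∙yz≈y∙xz +-commutativeSemigroup (indicator (c zero)) (indicator (c (suc w))) _ ⟩
  indicator (c (suc w)) + (indicator (c zero) + numColoured (c ∘ suc ∘ punchIn w))
    ≡⟨ cong (indicator (c (suc w)) +_) (numColoured-suc (c ∘ punchIn (suc w))) ⟨
  indicator (c (suc w)) + numColoured (c ∘ punchIn (suc w))
    ∎
  where open ≡-Reasoning

numColoured-punchIn-≤ : ∀ {n} (w : Fin (suc n)) (c : PartialColouring (suc n)) →
                        numColoured (c ∘ punchIn w) ≤ numColoured c
numColoured-punchIn-≤ w c = ≤-trans (m≤n+m _ (indicator (c w))) (≤-reflexive (sym (numColoured-punchIn w c)))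

numColoured≤suc-punchIn : ∀ {n} (w : Fin (suc n)) (c : PartialColouring (suc n)) →
                          numColoured c ≤ suc (numColoured (c ∘ punchIn w))
numColoured≤suc-punchIn w c = ≤-trans (≤-reflexive (numColoured-punchIn w c)) (+-monoˡ-≤ _ (indicator≤1 (c w)))

numColoured-erase : ∀ {n} (u : Fin (suc n)) (c : PartialColouring (suc n)) →
                    numColoured (erase u c) ≡ numColoured (c ∘ punchIn u)
numColoured-erase u c = begin
  numColoured (erase u c)
    ≡⟨ numColoured-punchIn u (erase u c) ⟩
  indicator (erase u c u) + numColoured (erase u c ∘ punchIn u)
    ≡⟨ cong₂ _+_ (cong indicator (erase-≡ u c)) (numColoured-cong (cong is-just ∘ erase-≢ c ∘ punchInᵢ≢i u)) ⟩
  numColoured (c ∘ punchIn u)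
    ∎
  where open ≡-Reasoning

numColoured-assign : ∀ {n} (v : Fin (suc n)) x (c : PartialColouring (suc n)) →
                     numColoured (assign v x c) ≡ suc (numColoured (c ∘ punchIn v))
numColoured-assign v x c = begin
  numColoured (assign v x c)
    ≡⟨ numColoured-punchIn v (assign v x c) ⟩
  indicator (assign v x c v) + numColoured (assign v x c ∘ punchIn v)
    ≡⟨ cong₂ _+_ (cong indicator (assign-≡ v x c)) (numColoured-cong (cong is-just ∘ assign-≢ x c ∘ punchInᵢ≢i v)) ⟩
  suc (numColoured (c ∘ punchIn v))
    ∎
  where open ≡-Reasoning

numColoured-erase-coloured : ∀ {n} (u : Fin n) (c : PartialColouring n) → is-just (c u) ≡ true →
                             numColoured c ≡ suc (numColoured (erase u c))
numColoured-erase-coloured {suc n} u c coloured = begin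
  numColoured c                                     ≡⟨ numColoured-punchIn u c ⟩
  indicator (c u) + numColoured (c ∘ punchIn u)     ≡⟨ cong (_+ numColoured (c ∘ punchIn u)) (indicator-coloured coloured) ⟩
  suc (numColoured (c ∘ punchIn u))                 ≡⟨ cong suc (numColoured-erase u c) ⟨
  suc (numColoured (erase u c))                     ∎
  where open ≡-Reasoning

numColoured-assign-coloured : ∀ {n} (v : Fin n) x (c : PartialColouring n) → is-just (c v) ≡ true →
                              numColoured (assign v x c) ≡ numColoured c
numColoured-assign-coloured {suc n} v x c coloured = begin
  numColoured (assign v x c)                        ≡⟨ numColoured-assign v x c ⟩
  suc (numColoured (c ∘ punchIn v))                 ≡⟨ cong (_+ numColoured (c ∘ punchIn v)) (indicator-coloured coloured) ⟨
  indicator (c v) + numColoured (c ∘ punchIn v)     ≡⟨ numColoured-punchIn v c ⟨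
  numColoured c                                     ∎
  where open ≡-Reasoning

numColoured-erase-mono : ∀ {n₁ n₂} {c₁ : PartialColouring n₁} {c₂ : PartialColouring n₂} u g →
                         numColoured c₂ ≤ numColoured c₁ → is-just (c₁ u) ≡ true → is-just (c₂ g) ≡ true →
                         numColoured (erase g c₂) ≤ numColoured (erase u c₁)
numColoured-erase-mono {c₁ = c₁} {c₂} u g le p₁ p₂ =
  ≤-pred (subst₂ _≤_ (numColoured-erase-coloured g c₂ p₂) (numColoured-erase-coloured u c₁ p₁) le)

numColoured-assign+indicator : ∀ {n} (v : Fin n) x (c : PartialColouring n) →
                               numColoured (assign v x c) + indicator (c v) ≡ suc (numColoured c)
numColoured-assign+indicator {suc n} v x c = begin
  numColoured (assign v x c) + indicator (c v)          ≡⟨ cong (_+ indicator (c v)) (numColoured-assign v x c) ⟩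
  suc (numColoured (c ∘ punchIn v) + indicator (c v))   ≡⟨ cong suc (+-comm _ (indicator (c v))) ⟩
  suc (indicator (c v) + numColoured (c ∘ punchIn v))   ≡⟨ cong suc (numColoured-punchIn v c) ⟨
  suc (numColoured c)                                   ∎
  where open ≡-Reasoning

numColoured-assign-≤ : ∀ {n} (v : Fin n) x (c : PartialColouring n) →
                       numColoured (assign v x c) ≤ suc (numColoured c)
numColoured-assign-≤ v x c = ≤-trans (m≤m+n _ (indicator (c v))) (≤-reflexive (numColoured-assign+indicator v x c))

⊑⇒extraColoured : ∀ {n} {c d : PartialColouring n} → c ⊑ d → numColoured c < numColoured d →
                  ∃[ g ] (c g ≡ nothing × is-just (d g) ≡ true)
⊑⇒extraColoured {zero} _ ()
⊑⇒extraColoured {suc n} {c} {d} c⊑d lt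
  rewrite numColoured-suc c | numColoured-suc d with c zero in c₀ | d zero in d₀
... | nothing | just _  = zero , c₀ , cong is-just d₀
... | nothing | nothing = let g , extra = ⊑⇒extraColoured (c⊑d ∘ suc) lt in suc g , extra
... | just _  | just _  = let g , extra = ⊑⇒extraColoured (c⊑d ∘ suc) (≤-pred lt) in suc g , extra
... | just y  | nothing with trans (sym d₀) (c⊑d zero y c₀)
... | ()

⊑-respˡ : ∀ {n} {c c′ d : PartialColouring n} → (∀ z → c z ≡ c′ z) → c′ ⊑ d → c ⊑ d
⊑-respˡ c≗c′ c′⊑d z y cz = c′⊑d z y (trans (sym (c≗c′ z)) cz)

⊑-coloured : ∀ {n} {c d : PartialColouring n} → c ⊑ d → ∀ z → is-just (c z) ≡ true → is-just (d z) ≡ true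
⊑-coloured {c = c} c⊑d z coloured with c z in cz
... | just y = cong is-just (c⊑d z y cz)

⊑-erase : ∀ {n} {c d : PartialColouring n} u → c ⊑ d → erase u c ⊑ erase u d
⊑-erase u c⊑d z = erase-pointwise (λ a b → ∀ y → a ≡ just y → b ≡ just y) u z (λ _ ()) (c⊑d z)

⊑-assign : ∀ {n} {c d : PartialColouring n} v x → c ⊑ d → assign v x c ⊑ assign v x d
⊑-assign v x c⊑d z = assign-pointwise (λ a b → ∀ y → a ≡ just y → b ≡ just y) v x x z (λ _ → id) (c⊑d z)

⊑-erase-uncoloured : ∀ {n} {c d : PartialColouring n} {g} → c ⊑ d → c g ≡ nothing → c ⊑ erase g d
⊑-erase-uncoloured {d = d} c⊑d cg z y cz =
  trans (erase-≢ d λ { refl → nothing≢just (trans (sym cg) cz) }) (c⊑d z y cz)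

⊑-assign-uncoloured : ∀ {n} {c d : PartialColouring n} {s} x → c ⊑ d → c s ≡ nothing → c ⊑ assign s x d
⊑-assign-uncoloured {d = d} x c⊑d cs z y cz =
  trans (assign-≢ x d λ { refl → nothing≢just (trans (sym cs) cz) }) (c⊑d z y cz)

_≟ᶜ_ : (x y : Colour) → Dec (x ≡ y)
red   ≟ᶜ red   = yes refl
red   ≟ᶜ blue  = no λ ()
red   ≟ᶜ green = no λ ()
blue  ≟ᶜ red   = no λ ()
blue  ≟ᶜ blue  = yes refl
blue  ≟ᶜ green = no λ ()
green ≟ᶜ red   = no λ ()
green ≟ᶜ blue  = no λ ()
green ≟ᶜ green = yes refl

SameColour : Maybe Colour → Maybe Colour → Set
SameColour a b = ∃[ x ] (a ≡ just x × b ≡ just x)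

sameColour? : ∀ a b → Dec (SameColour a b)
sameColour? nothing  _        = no λ { (_ , () , _) }
sameColour? (just _) nothing  = no λ { (_ , _ , ()) }
sameColour? (just x) (just y) = map′ (λ { refl → x , refl , refl }) (λ { (_ , refl , refl) → refl }) (x ≟ᶜ y)

MonochromaticEdge : ∀ {n} → (Fin n → Fin n → Bool) → PartialColouring n → Fin n → Fin n → Set
MonochromaticEdge adj c a b = adj a b ≡ true × SameColour (c a) (c b)

improper⇒monochromaticEdge : ∀ {n} adj (c : PartialColouring n) → ¬ ProperColouring adj c →
                             ∃[ a ] ∃[ b ] MonochromaticEdge adj c a b
improper⇒monochromaticEdge adj c improper =
  decidable-stable (any? λ a → any? λ b → (adj a b Bool.≟ true) ×-dec sameColour? (c a) (c b))
    λ noEdge → improper λ { u v x .x e cu cv refl → noEdge (u , v , e , x , cu , cv) }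

selected : ∀ {n} {c : PartialColouring n} → Move c → Fin n
selected (noErase v)       = v
selected (eraseThen _ _ v) = v

apply-≢ : ∀ {n} {c : PartialColouring n} (m : Move c) x y {z} → z ≢ selected m → apply m x z ≡ apply m y z
apply-≢ (noErase _)       x y z≢v = trans (assign-≢ x _ z≢v) (sym (assign-≢ y _ z≢v))
apply-≢ (eraseThen _ _ _) x y z≢v = trans (assign-≢ x _ z≢v) (sym (assign-≢ y _ z≢v))

apply-sameSupport : ∀ {n} {c : PartialColouring n} (m : Move c) x y → SameSupport (apply m x) (apply m y)
apply-sameSupport (noErase v)       x y z = assign-pointwise (λ a b → is-just a ≡ is-just b) v x y z refl refl
apply-sameSupport (eraseThen _ _ v) x y z = assign-pointwise (λ a b → is-just a ≡ is-just b) v x y z refl refl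

data Erasure {n} (c : PartialColouring n) : Set where
  keep    : Erasure c
  eraseAt : (u : Fin n) → is-just (c u) ≡ true → Erasure c

afterErasure : ∀ {n} {c : PartialColouring n} → Erasure c → PartialColouring n
afterErasure {c = c} keep          = c
afterErasure {c = c} (eraseAt u _) = erase u c

moveAfter : ∀ {n} {c : PartialColouring n} → Erasure c → Fin n → Move c
moveAfter keep          v = noErase v
moveAfter (eraseAt u p) v = eraseThen u p v

apply-moveAfter : ∀ {n} {c : PartialColouring n} (e : Erasure c) v x →
                  apply (moveAfter e v) x ≡ assign v x (afterErasure e)
apply-moveAfter keep          v x = refl
apply-moveAfter (eraseAt _ _) v x = refl

-- Transferring Spoiler's wins between games

improper⇒spoilerWins : ∀ {n} k adj r {c : PartialColouring n} → ¬ ProperColouring adj c → SpoilerWins k adj r c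
improper⇒spoilerWins k adj zero    improper = improper
improper⇒spoilerWins k adj (suc r) improper = inj₁ improper

spoilerWins-suc : ∀ {n} {k adj} r {c : PartialColouring n} → SpoilerWins k adj r c → SpoilerWins k adj (suc r) c
spoilerWins-suc zero    improper               = inj₁ improper
spoilerWins-suc (suc r) (inj₁ improper)        = inj₁ improper
spoilerWins-suc (suc r) (inj₂ (m , legal , f)) = inj₂ (m , legal , λ x → spoilerWins-suc r (f x))

spoilerWins⇒¬duplicatorWins : ∀ {n} {k adj} r {c : PartialColouring n} →
                              SpoilerWins k adj r c → ¬ DuplicatorWins k adj r c
spoilerWins⇒¬duplicatorWins zero    improper               proper            = improper proper
spoilerWins⇒¬duplicatorWins (suc r) (inj₁ improper)        (proper , _)      = improper proper
spoilerWins⇒¬duplicatorWins (suc r) (inj₂ (m , legal , f)) (_ , answer) with answer m legal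
... | x , duplicatorWins = spoilerWins⇒¬duplicatorWins r (f x) duplicatorWins

-- In a pass the second game skips the round: one answer suffices, since
-- Spoiler wins the first game against all of them.
data Reply {n₁ n₂} (_∼_ : PartialColouring n₁ → PartialColouring n₂ → Set)
           {c₁ : PartialColouring n₁} (m₁ : Move c₁) (c₂ : PartialColouring n₂) : Set where
  respond : (m₂ : Move c₂) → (∀ x → apply m₁ x ∼ apply m₂ x) → Reply _∼_ m₁ c₂
  pass    : (x : Colour) → apply m₁ x ∼ c₂ → Reply _∼_ m₁ c₂

record Simulation {n₁ n₂} (adj₁ : Fin n₁ → Fin n₁ → Bool) (adj₂ : Fin n₂ → Fin n₂ → Bool)
                  (_∼_ : PartialColouring n₁ → PartialColouring n₂ → Set) : Set where
  field
    fewerColoured  : ∀ {c₁ c₂} → c₁ ∼ c₂ → numColoured c₂ ≤ numColoured c₁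
    reflectsProper : ∀ {c₁ c₂} → c₁ ∼ c₂ → ProperColouring adj₂ c₂ → ProperColouring adj₁ c₁
    reply          : ∀ {c₁ c₂} → c₁ ∼ c₂ → (m₁ : Move c₁) → Reply _∼_ m₁ c₂

simulate : ∀ {n₁ n₂ k} {adj₁ : Fin n₁ → Fin n₁ → Bool} {adj₂ : Fin n₂ → Fin n₂ → Bool} {_∼_} →
           Simulation adj₁ adj₂ _∼_ → ∀ r {c₁ c₂} → c₁ ∼ c₂ → SpoilerWins k adj₁ r c₁ → SpoilerWins k adj₂ r c₂
simulate S zero    c₁∼c₂ improper        = improper ∘ Simulation.reflectsProper S c₁∼c₂
simulate S (suc r) c₁∼c₂ (inj₁ improper) = inj₁ (improper ∘ Simulation.reflectsProper S c₁∼c₂)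
simulate S (suc r) c₁∼c₂ (inj₂ (m₁ , legal , wins)) with Simulation.reply S c₁∼c₂ m₁
... | respond m₂ next = inj₂ (m₂ , (λ x → ≤-trans (Simulation.fewerColoured S (next x)) (legal x)) ,
                                   λ x → simulate S r (next x) (wins x))
... | pass x next     = spoilerWins-suc r (simulate S r next (wins x))

_⊆ₑ_ : ∀ {n} → (Fin n → Fin n → Bool) → (Fin n → Fin n → Bool) → Set
adj₁ ⊆ₑ adj₂ = ∀ u v → adj₁ u v ≡ true → adj₂ u v ≡ true

Touched : ∀ {n} → (Fin n → Fin n → Bool) → Fin n → Set
Touched adj z = ∃[ v ] (adj z v ≡ true ⊎ adj v z ≡ true)

record IsolatedRecolouring {n} (adj : Fin n → Fin n → Bool) (c₁ c₂ : PartialColouring n) : Set where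
  field
    sameSupport    : SameSupport c₁ c₂
    agreeOnTouched : ∀ z → Touched adj z → c₁ z ≡ c₂ z
open IsolatedRecolouring

isolatedRecolouring-refl : ∀ {n} {adj} (c : PartialColouring n) → IsolatedRecolouring adj c c
isolatedRecolouring-refl c = record { sameSupport = λ _ → refl ; agreeOnTouched = λ _ _ → refl }

isolatedRecolouring-erase : ∀ {n} {adj} {c₁ c₂ : PartialColouring n} u →
                            IsolatedRecolouring adj c₁ c₂ → IsolatedRecolouring adj (erase u c₁) (erase u c₂)
isolatedRecolouring-erase u rec = record
  { sameSupport    = λ z → erase-pointwise (λ a b → is-just a ≡ is-just b) u z refl (sameSupport rec z)
  ; agreeOnTouched = λ z t → erase-pointwise _≡_ u z refl (agreeOnTouched rec z t)
  }

isolatedRecolouring-assign : ∀ {n} {adj} {c₁ c₂ : PartialColouring n} v x →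
                             IsolatedRecolouring adj c₁ c₂ → IsolatedRecolouring adj (assign v x c₁) (assign v x c₂)
isolatedRecolouring-assign v x rec = record
  { sameSupport    = λ z → assign-pointwise (λ a b → is-just a ≡ is-just b) v x x z refl (sameSupport rec z)
  ; agreeOnTouched = λ z t → assign-pointwise _≡_ v x x z refl (agreeOnTouched rec z t)
  }

apply-isolatedRecolouring : ∀ {n} {adj} {c : PartialColouring n} (m : Move c) x y →
                            ¬ Touched adj (selected m) → IsolatedRecolouring adj (apply m x) (apply m y)
apply-isolatedRecolouring m x y untouched = record
  { sameSupport    = apply-sameSupport m x y
  ; agreeOnTouched = λ z t → apply-≢ m x y λ { refl → untouched t }
  }

isolatedRecolouringSimulation : ∀ {n} {adj₁ adj₂ : Fin n → Fin n → Bool} → adj₁ ⊆ₑ adj₂ →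
                                Simulation adj₁ adj₂ (IsolatedRecolouring adj₁)
isolatedRecolouringSimulation {adj₁ = adj₁} {adj₂} adj₁⊆adj₂ = record
  { fewerColoured  = λ rec → ≤-reflexive (numColoured-cong (sym ∘ sameSupport rec))
  ; reflectsProper = reflectsProper
  ; reply          = reply
  }
  where
  reflectsProper : ∀ {c₁ c₂} → IsolatedRecolouring adj₁ c₁ c₂ → ProperColouring adj₂ c₂ → ProperColouring adj₁ c₁
  reflectsProper rec proper u v x y e cu cv =
    proper u v x y (adj₁⊆adj₂ u v e) (trans (sym (agreeOnTouched rec u (v , inj₁ e))) cu)
                                     (trans (sym (agreeOnTouched rec v (u , inj₂ e))) cv)
  reply : ∀ {c₁ c₂} → IsolatedRecolouring adj₁ c₁ c₂ → (m₁ : Move c₁) → Reply (IsolatedRecolouring adj₁) m₁ c₂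
  reply rec (noErase v)       = respond (noErase v) λ x → isolatedRecolouring-assign v x rec
  reply rec (eraseThen u p v) = respond (eraseThen u (trans (sym (sameSupport rec u)) p) v)
                                        λ x → isolatedRecolouring-assign v x (isolatedRecolouring-erase u rec)

spoilerWins-mono : ∀ {n k} {adj₁ adj₂ : Fin n → Fin n → Bool} r {c₁ c₂} → adj₁ ⊆ₑ adj₂ →
                   IsolatedRecolouring adj₁ c₁ c₂ → SpoilerWins k adj₁ r c₁ → SpoilerWins k adj₂ r c₂
spoilerWins-mono r adj₁⊆adj₂ = simulate (isolatedRecolouringSimulation adj₁⊆adj₂) r

-- Deleting an isolated vertex

data PunchInView {m} (w : Fin (suc m)) : Fin (suc m) → Set where
  itself  : PunchInView w w
  punched : (v : Fin m) → PunchInView w (punchIn w v)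

punchInView : ∀ {m} (w v : Fin (suc m)) → PunchInView w v
punchInView w v with v ≟ w
... | yes refl = itself
... | no v≢w   = subst (PunchInView w) (punchIn-punchOut (v≢w ∘ sym)) (punched _)

module VertexDeletion {m} (w : Fin (suc m)) where

  -- c₂ may colour "ghost" vertices left uncoloured by c₁: when Spoiler erases
  -- a vertex and then selects w, the game without w cannot erase without also
  -- selecting, so the erased colour may survive there.
  record Tracks (c₁ : PartialColouring (suc m)) (c₂ : PartialColouring m) : Set where
    field
      extends : (c₁ ∘ punchIn w) ⊑ c₂
      fewer   : numColoured c₂ ≤ numColoured c₁
  open Tracks

  erase-w-punchIn : ∀ c z → erase w c (punchIn w z) ≡ c (punchIn w z)
  erase-w-punchIn c z = erase-≢ c (punchInᵢ≢i w z)

  assign-w-punchIn : ∀ x c z → assign w x c (punchIn w z) ≡ c (punchIn w z)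
  assign-w-punchIn x c z = assign-≢ x c (punchInᵢ≢i w z)

  tracks-assign : ∀ {c₁ c₂} → Tracks c₁ c₂ → ∀ v x → Tracks (assign (punchIn w v) x c₁) (assign v x c₂)
  tracks-assign {c₁} {c₂} t v x = record
    { extends = ⊑-respˡ (assign-punchIn w v x c₁) (⊑-assign v x (extends t))
    ; fewer   = +-cancelʳ-≤ (indicator (c₂ v)) _ _ (begin
        numColoured (assign v x c₂) + indicator (c₂ v)                 ≡⟨ numColoured-assign+indicator v x c₂ ⟩
        suc (numColoured c₂)                                           ≤⟨ s≤s (fewer t) ⟩
        suc (numColoured c₁)
          ≡⟨ numColoured-assign+indicator (punchIn w v) x c₁ ⟨
        numColoured (assign (punchIn w v) x c₁) + indicator (c₁ (punchIn w v))
          ≤⟨ +-monoʳ-≤ _ (indicator-mono (extends t v)) ⟩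
        numColoured (assign (punchIn w v) x c₁) + indicator (c₂ v)     ∎)
    }
    where open ≤-Reasoning

  tracks-erase : ∀ {c₁ c₂} → Tracks c₁ c₂ → ∀ u → is-just (c₁ u) ≡ true →
                 Σ (Erasure c₂) λ e → Tracks (erase u c₁) (afterErasure e)
  tracks-erase {c₁} {c₂} t u coloured with punchInView w u
  ... | punched u′ = eraseAt u′ coloured₂ , record
    { extends = ⊑-respˡ (erase-punchIn w u′ c₁) (⊑-erase u′ (extends t))
    ; fewer   = numColoured-erase-mono (punchIn w u′) u′ (fewer t) coloured coloured₂
    }
    where
    coloured₂ : is-just (c₂ u′) ≡ true
    coloured₂ = ⊑-coloured (extends t) u′ coloured
  ... | itself with numColoured c₂ ≤? numColoured (erase w c₁)
  ...   | yes fits    = keep , record { extends = ⊑-respˡ (erase-w-punchIn c₁) (extends t) ; fewer = fits }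
  ...   | no overflow
    with ⊑⇒extraColoured (extends t) (subst (_< numColoured c₂) (numColoured-erase w c₁) (≰⇒> overflow))
  ...     | g , ghostFree , ghostColoured = eraseAt g ghostColoured , record
    { extends = ⊑-respˡ (erase-w-punchIn c₁) (⊑-erase-uncoloured (extends t) ghostFree)
    ; fewer   = numColoured-erase-mono w g (fewer t) coloured ghostColoured
    }

  tracks-pass : ∀ {c₁ c₁′ c₂} → Tracks c₁ c₂ → (∀ z → c₁′ (punchIn w z) ≡ c₁ (punchIn w z)) →
                is-just (c₁′ w) ≡ true → Tracks c₁′ c₂
  tracks-pass {c₁} {c₁′} {c₂} t same coloured = record
    { extends = ⊑-respˡ same (extends t)
    ; fewer   = begin
        numColoured c₂                        ≤⟨ fewer t ⟩
        numColoured c₁                        ≤⟨ numColoured≤suc-punchIn w c₁ ⟩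
        suc (numColoured (c₁ ∘ punchIn w))    ≡⟨ cong suc (numColoured-cong (cong is-just ∘ same)) ⟨
        suc (numColoured (c₁′ ∘ punchIn w))   ≡⟨ cong suc (numColoured-erase w c₁′) ⟨
        suc (numColoured (erase w c₁′))       ≡⟨ numColoured-erase-coloured w c₁′ coloured ⟨
        numColoured c₁′                       ∎
    }
    where open ≤-Reasoning

  -- Spoiler erased punchIn w u and selected w: the game without w selects u
  -- again if its budget allows, and otherwise recolours a ghost vertex.
  tracks-reselect : ∀ {c₁ c₂} u → Tracks c₁ c₂ → c₁ (punchIn w u) ≡ nothing →
                    ∃[ s ] ∀ x → Tracks (assign w x c₁) (assign s x c₂)
  tracks-reselect {c₁} {c₂} u t uncoloured with numColoured c₂ ≤? numColoured (c₁ ∘ punchIn w)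
  ... | yes fits    = u , λ x → record
    { extends = ⊑-respˡ (assign-w-punchIn x c₁) (⊑-assign-uncoloured x (extends t) uncoloured)
    ; fewer   = begin
        numColoured (assign u x c₂)           ≤⟨ numColoured-assign-≤ u x c₂ ⟩
        suc (numColoured c₂)                  ≤⟨ s≤s fits ⟩
        suc (numColoured (c₁ ∘ punchIn w))    ≡⟨ numColoured-assign w x c₁ ⟨
        numColoured (assign w x c₁)           ∎
    }
    where open ≤-Reasoning
  ... | no overflow with ⊑⇒extraColoured (extends t) (≰⇒> overflow)
  ...   | g , ghostFree , ghostColoured = g , λ x → record
    { extends = ⊑-respˡ (assign-w-punchIn x c₁) (⊑-assign-uncoloured x (extends t) ghostFree)
    ; fewer   = begin
        numColoured (assign g x c₂)           ≡⟨ numColoured-assign-coloured g x c₂ ghostColoured ⟩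
        numColoured c₂                        ≤⟨ fewer t ⟩
        numColoured c₁                        ≤⟨ numColoured≤suc-punchIn w c₁ ⟩
        suc (numColoured (c₁ ∘ punchIn w))    ≡⟨ numColoured-assign w x c₁ ⟨
        numColoured (assign w x c₁)           ∎
    }
    where open ≤-Reasoning

  deletionSimulation : (adj : Fin (suc m) → Fin (suc m) → Bool) → ¬ Touched adj w →
                       Simulation adj (λ i j → adj (punchIn w i) (punchIn w j)) Tracks
  deletionSimulation adj untouched = record
    { fewerColoured  = fewer
    ; reflectsProper = reflectsProper
    ; reply          = reply
    }
    where
    reflectsProper : ∀ {c₁ c₂} → Tracks c₁ c₂ → ProperColouring (λ i j → adj (punchIn w i) (punchIn w j)) c₂ →
                     ProperColouring adj c₁
    reflectsProper t proper a b x y e ca cb x≡y with punchInView w a | punchInView w b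
    ... | itself     | _          = untouched (b , inj₁ e)
    ... | punched _  | itself     = untouched (a , inj₂ e)
    ... | punched a′ | punched b′ = proper a′ b′ x y e (extends t a′ x ca) (extends t b′ y cb) x≡y

    reply : ∀ {c₁ c₂} → Tracks c₁ c₂ → (m₁ : Move c₁) → Reply Tracks m₁ c₂
    reply {c₁} t (noErase v) with punchInView w v
    ... | itself     = pass red (tracks-pass t (assign-w-punchIn red c₁) (cong is-just (assign-≡ w red c₁)))
    ... | punched v′ = respond (noErase v′) (tracks-assign t v′)
    reply {c₁} t (eraseThen u coloured v) with tracks-erase t u coloured | punchInView w v
    ... | e , t′ | punched v′ = respond (moveAfter e v′) λ x →
      subst (Tracks _) (sym (apply-moveAfter e v′ x)) (tracks-assign t′ v′ x)
    ... | e , t′ | itself with punchInView w u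
    ...   | itself     = pass red (tracks-pass t (λ z → trans (assign-w-punchIn red _ z) (erase-w-punchIn c₁ z))
                                                 (cong is-just (assign-≡ w red _)))
    ...   | punched u′ with tracks-reselect u′ t′ (erase-≡ (punchIn w u′) c₁)
    ...     | s , t″ = respond (moveAfter e s) λ x → subst (Tracks _) (sym (apply-moveAfter e s x)) (t″ x)

spoilerWins-deleteIsolated : ∀ {m k} (adj : Fin (suc m) → Fin (suc m) → Bool) (w : Fin (suc m)) → ¬ Touched adj w →
                             ∀ r {c} → SpoilerWins k adj r c →
                             SpoilerWins k (λ i j → adj (punchIn w i) (punchIn w j)) r (c ∘ punchIn w)
spoilerWins-deleteIsolated adj w untouched r {c} =
  simulate (deletionSimulation adj untouched) r (record { extends = λ _ _ → id ; fewer = numColoured-punchIn-≤ w c })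
  where open VertexDeletion w

-- Winning cores

restrict : ∀ {n} → (Fin n → Fin n → Bool) → (Fin n → Bool) → Fin n → Fin n → Bool
restrict adj S u v = adj u v ∧ (S u ∧ S v)

restrict-⊆ : ∀ {n} (adj : Fin n → Fin n → Bool) S → restrict adj S ⊆ₑ adj
restrict-⊆ adj S u v = ∧-conicalˡ (adj u v) (S u ∧ S v)

restrict-endpoints : ∀ {n} (adj : Fin n → Fin n → Bool) S u v → restrict adj S u v ≡ true → S u ≡ true × S v ≡ true
restrict-endpoints adj S u v e = ∧-conicalˡ (S u) (S v) inS , ∧-conicalʳ (S u) (S v) inS
  where
  inS : S u ∧ S v ≡ true
  inS = ∧-conicalʳ (adj u v) (S u ∧ S v) e

restrict-edge : ∀ {n} (adj : Fin n → Fin n → Bool) S {u v} → adj u v ≡ true → S u ≡ true → S v ≡ true →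
                restrict adj S u v ≡ true
restrict-edge adj S e Su Sv rewrite e | Su | Sv = refl

restrict-mono : ∀ {n} (adj : Fin n → Fin n → Bool) {S T} → (∀ z → S z ≡ true → T z ≡ true) →
                restrict adj S ⊆ₑ restrict adj T
restrict-mono adj {S} {T} S⊆T u v e with restrict-endpoints adj S u v e
... | Su , Sv = restrict-edge adj T (restrict-⊆ adj S u v e) (S⊆T u Su) (S⊆T v Sv)

restrict-touched : ∀ {n} (adj : Fin n → Fin n → Bool) S {z} → Touched (restrict adj S) z → S z ≡ true
restrict-touched adj S {z} (v , inj₁ e) = proj₁ (restrict-endpoints adj S z v e)
restrict-touched adj S {z} (v , inj₂ e) = proj₂ (restrict-endpoints adj S v z e)

anyColour : (Colour → Bool) → Bool
anyColour P = P red ∨ P blue ∨ P green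

anyColour-true⁺ : ∀ P x → P x ≡ true → anyColour P ≡ true
anyColour-true⁺ P red   Px rewrite Px = refl
anyColour-true⁺ P blue  Px rewrite Px = ∨-zeroʳ (P red)
anyColour-true⁺ P green Px rewrite Px = trans (cong (P red ∨_) (∨-zeroʳ (P blue))) (∨-zeroʳ (P red))

anyColour-true⁻ : ∀ P → anyColour P ≡ true → ∃[ x ] P x ≡ true
anyColour-true⁻ P some with P red in Pr | P blue in Pb
... | true  | _     = red , Pr
... | false | true  = blue , Pb
... | false | false = green , some

allColours? : ∀ (P : Colour → Bool) → (∃[ x ] P x ≡ false) ⊎ (∀ x → P x ≡ true)
allColours? P with P red in Pr | P blue in Pb | P green in Pg
... | false | _     | _     = inj₁ (red , Pr)
... | true  | false | _     = inj₁ (blue , Pb)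
... | true  | true  | false = inj₁ (green , Pg)
... | true  | true  | true  = inj₂ λ { red → Pr ; blue → Pb ; green → Pg }

_++ʷ_ : ∀ {k} {H : PrecolouredGraph k} {p q s a b} → Walk H p q a → Walk H q s b → Walk H p s (a + b)
here _   ++ʷ walk = walk
step e w ++ʷ walk = step e (w ++ʷ walk)

CloseWithin : ∀ {k} (H : PrecolouredGraph k) → (Fin (n H) → Bool) → ℕ → Set
CloseWithin H S d = ∀ p q → S p ≡ true → S q ≡ true → ∃[ ℓ ] (ℓ ≤ d × Walk H p q ℓ)

record WinningCore {k} (H : PrecolouredGraph k) (r : ℕ) (c : PartialColouring (n H)) : Set where
  field
    member : Fin (n H) → Bool
    close  : CloseWithin H member (2 ^ r)
    wins   : SpoilerWins k (restrict (adj H) member) r c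
open WinningCore

module _ {k} (H : PrecolouredGraph k) where

  monochromaticCore : ∀ r {c} a b → MonochromaticEdge (adj H) c a b → WinningCore H r c
  monochromaticCore r a b (e , x , ca , cb) = record
    { member = pair
    ; close  = pair-close
    ; wins   = improper⇒spoilerWins k _ r λ proper →
                 proper a b x x (restrict-edge (adj H) pair e a∈pair b∈pair) ca cb refl
    }
    where
    pair : Fin (n H) → Bool
    pair z = does (z ≟ a) ∨ does (z ≟ b)
    a∈pair : pair a ≡ true
    a∈pair = cong (_∨ does (a ≟ b)) (dec-true (a ≟ a) refl)
    b∈pair : pair b ≡ true
    b∈pair = trans (cong (does (b ≟ a) ∨_) (dec-true (b ≟ b) refl)) (∨-zeroʳ (does (b ≟ a)))
    pair-sound : ∀ z → pair z ≡ true → z ≡ a ⊎ z ≡ b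
    pair-sound z z∈pair with z ≟ a | z ≟ b
    ... | yes z≡a | _       = inj₁ z≡a
    ... | no _    | yes z≡b = inj₂ z≡b
    pair-close : CloseWithin H pair (2 ^ r)
    pair-close p q p∈ q∈ with pair-sound p p∈ | pair-sound q q∈
    ... | inj₁ refl | inj₁ refl = 0 , z≤n , here a
    ... | inj₂ refl | inj₂ refl = 0 , z≤n , here b
    ... | inj₁ refl | inj₂ refl = 1 , m^n>0 2 r , step e (here b)
    ... | inj₂ refl | inj₁ refl = 1 , m^n>0 2 r , step (adj-sym H a b e) (here a)

  prunedCore : ∀ r {c} (m : Move c) → Legal k m → ∀ x (C : WinningCore H r (apply m x)) →
               member C (selected m) ≡ false → WinningCore H (suc r) c
  prunedCore r m legal x C outside = record
    { member = member C
    ; close  = λ p q p∈ q∈ → let ℓ , ℓ≤ , walk = close C p q p∈ q∈ in ℓ , ≤-trans ℓ≤ (m≤m+n _ _) , walk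
    ; wins   = inj₂ (m , legal , λ y →
                 spoilerWins-mono r (λ _ _ → id) (apply-isolatedRecolouring m x y untouched) (wins C))
    }
    where
    untouched : ¬ Touched (restrict (adj H) (member C)) (selected m)
    untouched touched = false≢true (trans (sym outside) (restrict-touched (adj H) (member C) touched))

  unionCore : ∀ r {c} (m : Move c) → Legal k m → (C : ∀ x → WinningCore H r (apply m x)) →
              (∀ x → member (C x) (selected m) ≡ true) → WinningCore H (suc r) c
  unionCore r m legal C inside = record
    { member = union
    ; close  = union-close
    ; wins   = inj₂ (m , legal , λ y →
                 spoilerWins-mono r (restrict-mono (adj H) (λ z → anyColour-true⁺ (λ x → member (C x) z) y))
                                    (isolatedRecolouring-refl _) (wins (C y)))
    }
    where
    union : Fin (n H) → Bool
    union z = anyColour λ x → member (C x) z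
    union-close : CloseWithin H union (2 ^ suc r)
    union-close p q p∈ q∈ with anyColour-true⁻ _ p∈ | anyColour-true⁻ _ q∈
    ... | x , p∈x | y , q∈y
      with close (C x) p (selected m) p∈x (inside x) | close (C y) (selected m) q (inside y) q∈y
    ...   | ℓ₁ , ℓ₁≤ , walk₁ | ℓ₂ , ℓ₂≤ , walk₂ = ℓ₁ + ℓ₂ , +-mono-≤ ℓ₁≤ (≤-trans ℓ₂≤ (m≤m+n _ 0)) , walk₁ ++ʷ walk₂

  improperCore : ∀ r {c} → ¬ ProperColouring (adj H) c → WinningCore H r c
  improperCore r {c} improper with improper⇒monochromaticEdge (adj H) c improper
  ... | a , b , monochromatic = monochromaticCore r a b monochromatic

  moveCore : ∀ r {c} (m : Move c) → Legal k m → (∀ x → WinningCore H r (apply m x)) → WinningCore H (suc r) c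
  moveCore r m legal core with allColours? (λ x → member (core x) (selected m))
  ... | inj₁ (x , outside) = prunedCore r m legal x (core x) outside
  ... | inj₂ inside        = unionCore r m legal core inside

  winningCore : ∀ r c → SpoilerWins k (adj H) r c → WinningCore H r c
  winningCore zero    c improper                  = improperCore zero improper
  winningCore (suc r) c (inj₁ improper)           = improperCore (suc r) improper
  winningCore (suc r) c (inj₂ (m , legal , wins)) = moveCore r m legal λ x → winningCore r (apply m x) (wins x)

-- Graphs in M

restrictGraph : ∀ {k} (H : PrecolouredGraph k) → (Fin (n H) → Bool) → PrecolouredGraph k
restrictGraph H S = record
  { n      = n H
  ; adj    = restrict (adj H) S
  ; sym    = λ u v e → let Su , Sv = restrict-endpoints (adj H) S u v e in
                       restrict-edge (adj H) S (adj-sym H u v (restrict-⊆ (adj H) S u v e)) Sv Su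
  ; irrefl = λ v → cong (_∧ (S v ∧ S v)) (irrefl H v)
  ; col    = col H
  ; atMost = atMost H
  }

restrictGraph-proper : ∀ {k} (H : PrecolouredGraph k) S {w z} → S w ≡ false → adj H w z ≡ true →
                       ProperSubgraph (restrictGraph H S) H
restrictGraph-proper H S {w} {z} outside e =
  id , record { inj = id ; edges = restrict-⊆ (adj H) S ; colours = λ _ _ → id } ,
  inj₂ (inj₁ (w , z , e , trans (cong (λ b → adj H w z ∧ (b ∧ S z)) outside) (∧-zeroʳ (adj H w z))))

deleteVertex : ∀ {k} (H : PrecolouredGraph k) → Fin (n H) → PrecolouredGraph k
deleteVertex H@record { n = suc m } w = record
  { n      = m
  ; adj    = λ i j → adj H (punchIn w i) (punchIn w j)
  ; sym    = λ i j → adj-sym H (punchIn w i) (punchIn w j)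
  ; irrefl = λ i → irrefl H (punchIn w i)
  ; col    = col H ∘ punchIn w
  ; atMost = ≤-trans (numColoured-punchIn-≤ w (col H)) (atMost H)
  }

deleteVertex-proper : ∀ {k} (H : PrecolouredGraph k) w → ProperSubgraph (deleteVertex H w) H
deleteVertex-proper H@record { n = suc m } w =
  punchIn w , record { inj = punchIn-injective w _ _ ; edges = λ _ _ → id ; colours = λ _ _ → id } ,
  inj₁ (w , punchInᵢ≢i w)

inM⇒hasNeighbour : ∀ {k r} (H : PrecolouredGraph k) → InM k r H → ∀ w → ∃[ z ] adj H w z ≡ true
inM⇒hasNeighbour {r = r} H@record { n = suc m } (spoilerWins , minimal) w =
  decidable-stable (any? λ z → adj H w z Bool.≟ true) λ lonely →
    spoilerWins⇒¬duplicatorWins r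
      (spoilerWins-deleteIsolated (adj H) w (untouched lonely) r spoilerWins)
      (minimal (deleteVertex H w) (deleteVertex-proper H w))
  where
  untouched : ¬ (∃[ z ] adj H w z ≡ true) → ¬ Touched (adj H) w
  untouched lonely (z , inj₁ e) = lonely (z , e)
  untouched lonely (z , inj₂ e) = lonely (z , adj-sym H z w e)

inM⇒core-spanning : ∀ {k r} (H : PrecolouredGraph k) → InM k r H → (C : WinningCore H r (col H)) →
                    ∀ w → member C w ≡ true
inM⇒core-spanning {r = r} H inM@(_ , minimal) C w with member C w in outside
... | true  = refl
... | false with inM⇒hasNeighbour H inM w
...   | z , e = ⊥-elim (spoilerWins⇒¬duplicatorWins r (wins C)
                          (minimal (restrictGraph H (member C)) (restrictGraph-proper H (member C) outside e)))

lemma3 : (k r : ℕ) (H : PrecolouredGraph k) → InM k r H → DiameterAtMost H (2 ^ r)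
lemma3 k r H inM@(spoilerWins , _) u v = close C u v (inM⇒core-spanning H inM C u) (inM⇒core-spanning H inM C v)
  where
  C : WinningCore H r (col H)
  C = winningCore H r (col H) spoilerWins
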